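{- Let $\mathbf u,\mathbf v,\mathbf w$ be finite real sequences of lengths $p,q,s$ respectively, with concatenation $(\mathbf u,\mathbf v,\mathbf w)$, and let $k\in\mathbb{Z}_+$. Then $$S(M^k(\mathbf u,\mathbf v,\mathbf w))=S(M^k(\mathbf u))+S(M^k(\mathbf v))+S(M^k(\mathbf w))+\sum_{\ell=1}^k\left(S(M^{k-\ell}(\mathbf u))\binom{q+s+\ell-1}{\ell}+S(M^{k-\ell}(\mathbf v))\binom{s+\ell-1}{\ell}\right).$$
   Context: For a finite sequence $\mathbf a=(a_1,\dots,a_m)$, $S(\mathbf a)=\sum_i a_i$ and $M(\mathbf a)=(a_1,a_1+a_2,\dots,a_1+\dots+a_m)$; $M^0$ is the identity and $M^k=M\circ M^{k-1}$. -}

module Defs where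

open import Level using (Level)
open import Algebra.Bundles using (CommutativeRing)
open import Data.Nat as ℕ using (ℕ; zero; suc)
open import Data.Vec using (Vec; []; _∷_; map)

-- Finite sequences over (the carrier of) a commutative ring R.
-- The paper works over ℝ; ℝ is one instance of R.
module Seq {c ℓ : Level} (R : CommutativeRing c ℓ) where
  open CommutativeRing R

  S : ∀ {m} → Vec Carrier m → Carrier
  S []       = 0#
  S (x ∷ xs) = x + S xs

  -- M(a) = (a₁, a₁+a₂, …, a₁+…+aₘ)
  M : ∀ {m} → Vec Carrier m → Vec Carrier m
  M []       = []
  M (x ∷ xs) = x ∷ map (x +_) (M xs)

  M^ : ℕ → ∀ {m} → Vec Carrier m → Vec Carrier m
  M^ zero    a = a
  M^ (suc k) a = M (M^ k a)

  fromℕ : ℕ → Carrier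
  fromℕ zero    = 0#
  fromℕ (suc n) = 1# + fromℕ n

  Σ1to : ℕ → (ℕ → Carrier) → Carrier
  Σ1to zero    f = 0#
  Σ1to (suc k) f = Σ1to k f + f (suc k)

module Submission where

-- M is linear, and on a concatenation it acts blockwise:
--   M (a ++ b) = M a ++ (S a + M b)        (S a added to every entry).
-- Iterating, M^k (u ++ v) = M^k u ++ T_k, where the tail block T_k obeys
-- T_0 = v and T_{k+1} = S (M^k u) + M T_k.  By linearity, adding a constant
-- d to every entry of a vector y of length m adds d * S (M^j 1_m) to
-- S (M^j y), where 1_m is the all-ones vector; hence
--   S (M^k (u ++ v)) = S (M^k u) + S (M^k v)
--                      + Σ_{l=1}^k S (M^{k-l} u) * S (M^{l-1} 1_q).
-- Splitting 1_{q+1} = 1_q ++ (1) and applying Pascal's rule shows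
-- S (M^j 1_q) = C(q+j, j+1), which gives the two-block formula.  The
-- three-block formula (corollary3) applies it to u ++ (v ++ w) and then to
-- v ++ w, and merges the two sums.

open import Defs
open import Algebra.Bundles using (CommutativeRing)
open import Data.Nat using (ℕ; _≤_; _∸_) renaming (_+_ to _+ℕ_)
open import Data.Nat.Combinatorics using (_C_)
open import Data.Vec using (Vec; _++_)

open import Level using (Level)
open import Data.Nat using (zero; suc; pred)
open import Data.Nat.Properties as ℕ using (n<1+n)
open import Data.Nat.Combinatorics using (k>n⇒nCk≡0; nCk+nC[k+1]≡[n+1]C[k+1])
open import Data.Vec using ([]; _∷_; map; zipWith; replicate)
open import Relation.Binary.PropositionalEquality as ≡ using (_≡_)
import Algebra.Properties.CommutativeSemigroup as CommSemigroupProperties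
import Data.Vec.Relation.Binary.Equality.Setoid as VecEquality
import Relation.Binary.Reasoning.Setoid as SetoidReasoning

module Blocks {c ℓ : Level} (R : CommutativeRing c ℓ) where
  open CommutativeRing R
  open Seq R
  open CommSemigroupProperties +-commutativeSemigroup using (interchange; xy∙z≈x∙zy)
  open VecEquality setoid using (_≋_; []; _∷_; ≋-refl; ≋-sym; ≋-trans; map⁺; ++⁺; map-++; ++-identityʳ; replicate-shiftʳ)
  open SetoidReasoning setoid

  -- S, M and M^k respect entrywise equality of vectors (of possibly
  -- non-definitionally equal lengths, such as q + 1 and suc q).

  S-cong : ∀ {m n} {a : Vec Carrier m} {b : Vec Carrier n} → a ≋ b → S a ≈ S b
  S-cong []          = refl
  S-cong (x≈y ∷ a≋b) = +-cong x≈y (S-cong a≋b)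

  M-cong : ∀ {m n} {a : Vec Carrier m} {b : Vec Carrier n} → a ≋ b → M a ≋ M b
  M-cong []          = []
  M-cong (x≈y ∷ a≋b) = x≈y ∷ map⁺ (+-cong x≈y) (M-cong a≋b)

  M^-cong : ∀ j {m n} {a : Vec Carrier m} {b : Vec Carrier n} → a ≋ b → M^ j a ≋ M^ j b
  M^-cong zero    a≋b = a≋b
  M^-cong (suc j) a≋b = M-cong (M^-cong j a≋b)

  -- M^ unfolds on the outside; this moves one application of M inside.
  -- It lets the induction on the tail block trade M^j ∘ M for M^(j+1).
  M^-M : ∀ j {m} (a : Vec Carrier m) → M^ j (M a) ≡ M^ (suc j) a
  M^-M zero    a = ≡.refl
  M^-M (suc j) a = ≡.cong M (M^-M j a)

  M^-[] : ∀ j → M^ j [] ≡ []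
  M^-[] zero    = ≡.refl
  M^-[] (suc j) = ≡.cong M (M^-[] j)

  S-++ : ∀ {m n} (a : Vec Carrier m) (b : Vec Carrier n) → S (a ++ b) ≈ S a + S b
  S-++ []      b = sym (+-identityˡ (S b))
  S-++ (x ∷ a) b = trans (+-cong refl (S-++ a b)) (sym (+-assoc x (S a) (S b)))

  infixl 6 _⊕_
  infixl 7 _·_

  _⊕_ : ∀ {m} → Vec Carrier m → Vec Carrier m → Vec Carrier m
  _⊕_ = zipWith _+_

  _·_ : ∀ {m} → Carrier → Vec Carrier m → Vec Carrier m
  d · a = map (d *_) a

  M-⊕ : ∀ {m} (a b : Vec Carrier m) → M (a ⊕ b) ≋ M a ⊕ M b
  M-⊕ []      []      = []
  M-⊕ (x ∷ a) (y ∷ b) = refl ∷ ≋-trans (map⁺ (+-cong refl) (M-⊕ a b)) (shifted (M a) (M b))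
    where
    shifted : ∀ {m} (a′ b′ : Vec Carrier m) → map ((x + y) +_) (a′ ⊕ b′) ≋ map (x +_) a′ ⊕ map (y +_) b′
    shifted []       []       = []
    shifted (s ∷ a′) (t ∷ b′) = interchange x y s t ∷ shifted a′ b′

  M-· : ∀ {m} d (a : Vec Carrier m) → M (d · a) ≋ d · M a
  M-· d []      = []
  M-· d (x ∷ a) = refl ∷ ≋-trans (map⁺ (+-cong refl) (M-· d a)) (shifted (M a))
    where
    shifted : ∀ {m} (a′ : Vec Carrier m) → map ((d * x) +_) (d · a′) ≋ d · map (x +_) a′
    shifted []       = []
    shifted (t ∷ a′) = sym (distribˡ d x t) ∷ shifted a′

  M^-⊕ : ∀ j {m} (a b : Vec Carrier m) → M^ j (a ⊕ b) ≋ M^ j a ⊕ M^ j b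
  M^-⊕ zero    a b = ≋-refl
  M^-⊕ (suc j) a b = ≋-trans (M-cong (M^-⊕ j a b)) (M-⊕ (M^ j a) (M^ j b))

  M^-· : ∀ j {m} d (a : Vec Carrier m) → M^ j (d · a) ≋ d · M^ j a
  M^-· zero    d a = ≋-refl
  M^-· (suc j) d a = ≋-trans (M-cong (M^-· j d a)) (M-· d (M^ j a))

  S-⊕ : ∀ {m} (a b : Vec Carrier m) → S (a ⊕ b) ≈ S a + S b
  S-⊕ []      []      = sym (+-identityˡ 0#)
  S-⊕ (x ∷ a) (y ∷ b) = trans (+-cong refl (S-⊕ a b)) (interchange x y (S a) (S b))

  S-· : ∀ {m} d (a : Vec Carrier m) → S (d · a) ≈ d * S a
  S-· d []      = sym (zeroʳ d)
  S-· d (x ∷ a) = trans (+-cong refl (S-· d a)) (sym (distribˡ d x (S a)))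

  ones : ∀ m → Vec Carrier m
  ones m = replicate m 1#

  σ : ℕ → ℕ → Carrier
  σ m j = S (M^ j (ones m))

  -- Adding a constant d to every entry of y adds d * σ m j to S (M^j y),
  -- since d + y = y ⊕ d · 1_m and M^j, S are linear.
  S-M^-shift : ∀ j {m} d (y : Vec Carrier m) → S (M^ j (map (d +_) y)) ≈ S (M^ j y) + d * σ m j
  S-M^-shift j {m} d y = begin
    S (M^ j (map (d +_) y))           ≈⟨ S-cong (M^-cong j (as-sum y)) ⟩
    S (M^ j (y ⊕ d · ones m))         ≈⟨ S-cong (M^-⊕ j y (d · ones m)) ⟩
    S (M^ j y ⊕ M^ j (d · ones m))    ≈⟨ S-⊕ (M^ j y) (M^ j (d · ones m)) ⟩
    S (M^ j y) + S (M^ j (d · ones m)) ≈⟨ +-cong refl (S-cong (M^-· j d (ones m))) ⟩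
    S (M^ j y) + S (d · M^ j (ones m)) ≈⟨ +-cong refl (S-· d (M^ j (ones m))) ⟩
    S (M^ j y) + d * σ m j            ∎
    where
    as-sum : ∀ {n} (z : Vec Carrier n) → map (d +_) z ≋ z ⊕ d · ones n
    as-sum []      = []
    as-sum (x ∷ z) = trans (+-comm d x) (+-cong refl (sym (*-identityʳ d))) ∷ as-sum z

  M-++ : ∀ {m n} (a : Vec Carrier m) (b : Vec Carrier n) → M (a ++ b) ≋ M a ++ map (S a +_) (M b)
  M-++ []      b = ≋-sym (zero-shift (M b))
    where
    zero-shift : ∀ {n} (z : Vec Carrier n) → map (0# +_) z ≋ z
    zero-shift []      = []
    zero-shift (x ∷ z) = +-identityˡ x ∷ zero-shift z
  M-++ (x ∷ a) b =
    refl ∷ ≋-trans (map⁺ (+-cong refl) (M-++ a b))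
             (≋-trans (map-++ (x +_) (M a)) (++⁺ ≋-refl (double-shift (M b))))
    where
    double-shift : ∀ {n} (z : Vec Carrier n) → map (x +_) (map (S a +_) z) ≋ map ((x + S a) +_) z
    double-shift []      = []
    double-shift (t ∷ z) = sym (+-assoc x (S a) t) ∷ double-shift z

  -- The tail block T_k of M^k (u ++ v): T_0 = v, T_{k+1} = S (M^k u) + M T_k.
  tailBlock : ∀ {p q} → Vec Carrier p → Vec Carrier q → ℕ → Vec Carrier q
  tailBlock u v zero    = v
  tailBlock u v (suc k) = map (S (M^ k u) +_) (M (tailBlock u v k))

  M^-++ : ∀ {p q} (u : Vec Carrier p) (v : Vec Carrier q) k → M^ k (u ++ v) ≋ M^ k u ++ tailBlock u v k
  M^-++ u v zero    = ≋-refl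
  M^-++ u v (suc k) = ≋-trans (M-cong (M^-++ u v k)) (M-++ (M^ k u) (tailBlock u v k))

  Σ-cong : ∀ k {f g : ℕ → Carrier} → (∀ l → f (suc l) ≈ g (suc l)) → Σ1to k f ≈ Σ1to k g
  Σ-cong zero    f≈g = refl
  Σ-cong (suc k) f≈g = +-cong (Σ-cong k f≈g) (f≈g k)

  Σ-peel : ∀ k (f : ℕ → Carrier) → Σ1to (suc k) f ≈ f 1 + Σ1to k (λ l → f (suc l))
  Σ-peel zero    f = trans (+-identityˡ (f 1)) (sym (+-identityʳ (f 1)))
  Σ-peel (suc k) f = trans (+-cong (Σ-peel k f) refl) (+-assoc (f 1) _ _)

  Σ-+ : ∀ k (f g : ℕ → Carrier) → Σ1to k (λ l → f l + g l) ≈ Σ1to k f + Σ1to k g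
  Σ-+ zero    f g = sym (+-identityˡ 0#)
  Σ-+ (suc k) f g = trans (+-cong (Σ-+ k f g) refl) (interchange _ _ _ _)

  -- The
  -- statement is generalised over j so that the induction on k goes through.
  S-M^-tailBlock : ∀ {p q} (u : Vec Carrier p) (v : Vec Carrier q) k j →
    S (M^ j (tailBlock u v k)) ≈ S (M^ (j +ℕ k) v) + Σ1to k (λ l → S (M^ (k ∸ l) u) * σ q (j +ℕ pred l))
  S-M^-tailBlock u v zero j = begin
    S (M^ j v)             ≡⟨ ≡.cong (λ n → S (M^ n v)) (≡.sym (ℕ.+-identityʳ j)) ⟩
    S (M^ (j +ℕ 0) v)      ≈⟨ sym (+-identityʳ _) ⟩
    S (M^ (j +ℕ 0) v) + 0# ∎
  S-M^-tailBlock {q = q} u v (suc k) j = begin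
    S (M^ j (map (d +_) (M T)))                     ≈⟨ S-M^-shift j d (M T) ⟩
    S (M^ j (M T)) + d * σ q j                      ≡⟨ ≡.cong (λ z → S z + d * σ q j) (M^-M j T) ⟩
    S (M^ (suc j) T) + d * σ q j                    ≈⟨ +-cong (S-M^-tailBlock u v k (suc j)) refl ⟩
    S (M^ (suc j +ℕ k) v) + Σ1to k later + d * σ q j ≈⟨ xy∙z≈x∙zy _ _ _ ⟩
    S (M^ (suc j +ℕ k) v) + (d * σ q j + Σ1to k later)
      -- reindex: suc j + k = j + suc k and suc j + l = j + suc l
      ≈⟨ +-cong (reflexive (≡.cong (λ n → S (M^ n v)) (≡.sym (ℕ.+-suc j k))))
                (+-cong (reflexive (≡.cong (λ n → d * σ q n) (≡.sym (ℕ.+-identityʳ j))))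
                        (Σ-cong k (λ l → reflexive (≡.cong (λ n → S (M^ (k ∸ suc l) u) * σ q n)
                                                            (≡.sym (ℕ.+-suc j l)))))) ⟩
    S (M^ (j +ℕ suc k) v) + (f 1 + Σ1to k (λ l → f (suc l))) ≈⟨ +-cong refl (sym (Σ-peel k f)) ⟩
    S (M^ (j +ℕ suc k) v) + Σ1to (suc k) f          ∎
    where
    T : Vec Carrier q
    T = tailBlock u v k
    d : Carrier
    d = S (M^ k u)
    later : ℕ → Carrier
    later l = S (M^ (k ∸ l) u) * σ q (suc j +ℕ pred l)
    f : ℕ → Carrier
    f l = S (M^ (suc k ∸ l) u) * σ q (j +ℕ pred l)

  fromℕ-+ : ∀ a b → fromℕ (a +ℕ b) ≈ fromℕ a + fromℕ b
  fromℕ-+ zero    b = sym (+-identityˡ (fromℕ b))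
  fromℕ-+ (suc a) b = trans (+-cong refl (fromℕ-+ a b)) (sym (+-assoc 1# (fromℕ a) (fromℕ b)))

  pascal : ∀ {x y} n k → x ≈ fromℕ (n C suc k) → y ≈ fromℕ (n C k) → x + y ≈ fromℕ (suc n C suc k)
  pascal {x} {y} n k x≈ y≈ = begin
    x + y                            ≈⟨ +-cong x≈ y≈ ⟩
    fromℕ (n C suc k) + fromℕ (n C k) ≈⟨ +-comm _ _ ⟩
    fromℕ (n C k) + fromℕ (n C suc k) ≈⟨ sym (fromℕ-+ (n C k) (n C suc k)) ⟩
    fromℕ (n C k +ℕ n C suc k)        ≡⟨ ≡.cong fromℕ (nCk+nC[k+1]≡[n+1]C[k+1] n k) ⟩
    fromℕ (suc n C suc k)             ∎

  S-shift-singleton : ∀ d (t : Vec Carrier 1) → S (map (d +_) (M t)) ≈ d + S t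
  S-shift-singleton d (x ∷ []) = +-assoc d x 0#

  -- 1_{q+1} = 1_q ++ (1), so σ (q+1) j is σ q j plus the sum of a one-entry tail block.
  σ-suc : ∀ q j → σ (suc q) j ≈ σ q j + S (tailBlock (ones q) (1# ∷ []) j)
  σ-suc q j = begin
    S (M^ j (ones (suc q)))                         ≈⟨ S-cong (M^-cong j (≋-sym ones-split)) ⟩
    S (M^ j (ones q ++ (1# ∷ [])))                  ≈⟨ S-cong (M^-++ (ones q) (1# ∷ []) j) ⟩
    S (M^ j (ones q) ++ tailBlock (ones q) (1# ∷ []) j) ≈⟨ S-++ (M^ j (ones q)) _ ⟩
    σ q j + S (tailBlock (ones q) (1# ∷ []) j)      ∎
    where
    ones-split : ones q ++ (1# ∷ []) ≋ ones (suc q)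
    ones-split = ≋-trans (replicate-shiftʳ q 1# []) (++-identityʳ (ones (suc q)))

  -- Joint induction: σ q j = C(q+j, j+1), and the entry appended to 1_q
  -- evolves as C(q+j, j); both steps are Pascal's rule.
  σ-binomial : ∀ q j → σ q j ≈ fromℕ ((q +ℕ j) C suc j)
  last-binomial : ∀ q j → S (tailBlock (ones q) (1# ∷ []) j) ≈ fromℕ ((q +ℕ j) C j)

  σ-binomial zero j rewrite M^-[] j | k>n⇒nCk≡0 (n<1+n j) = refl
  σ-binomial (suc q) j =
    trans (σ-suc q j) (pascal (q +ℕ j) j (σ-binomial q j) (last-binomial q j))

  last-binomial q zero    = refl
  last-binomial q (suc j) = begin
    S (map (σ q j +_) (M (tailBlock (ones q) (1# ∷ []) j))) ≈⟨ S-shift-singleton (σ q j) (tailBlock (ones q) (1# ∷ []) j) ⟩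
    σ q j + S (tailBlock (ones q) (1# ∷ []) j)              ≈⟨ pascal (q +ℕ j) j (σ-binomial q j) (last-binomial q j) ⟩
    fromℕ (suc (q +ℕ j) C suc j)                            ≡⟨ ≡.cong (λ n → fromℕ (n C suc j)) (≡.sym (ℕ.+-suc q j)) ⟩
    fromℕ ((q +ℕ suc j) C suc j)                            ∎

  two-blocks : ∀ {p q} (u : Vec Carrier p) (v : Vec Carrier q) k →
    S (M^ k (u ++ v)) ≈ S (M^ k u) + S (M^ k v) + Σ1to k (λ l → S (M^ (k ∸ l) u) * fromℕ ((q +ℕ l ∸ 1) C l))
  two-blocks {q = q} u v k = begin
    S (M^ k (u ++ v))                                   ≈⟨ S-cong (M^-++ u v k) ⟩
    S (M^ k u ++ tailBlock u v k)                       ≈⟨ S-++ (M^ k u) (tailBlock u v k) ⟩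
    S (M^ k u) + S (tailBlock u v k)                    ≈⟨ +-cong refl (S-M^-tailBlock u v k 0) ⟩
    S (M^ k u) + (S (M^ k v) + Σ1to k (λ l → S (M^ (k ∸ l) u) * σ q (pred l)))
      ≈⟨ sym (+-assoc _ _ _) ⟩
    S (M^ k u) + S (M^ k v) + Σ1to k (λ l → S (M^ (k ∸ l) u) * σ q (pred l))
      ≈⟨ +-cong refl (Σ-cong k (λ l → *-cong refl (binomial l))) ⟩
    S (M^ k u) + S (M^ k v) + Σ1to k (λ l → S (M^ (k ∸ l) u) * fromℕ ((q +ℕ l ∸ 1) C l)) ∎
    where
    binomial : ∀ l → σ q l ≈ fromℕ ((q +ℕ suc l ∸ 1) C suc l)
    binomial l = trans (σ-binomial q l) (reflexive (≡.cong (λ n → fromℕ ((n ∸ 1) C suc l)) (≡.sym (ℕ.+-suc q l))))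

-- Corollary 3: apply the two-block formula to u ++ (v ++ w), then to v ++ w,
-- regroup, and merge the two sums into one.
corollary3 : ∀ {c ℓ} (R : CommutativeRing c ℓ) →
    let open CommutativeRing R in let open Seq R in
    (p q s : ℕ) (u : Vec Carrier p) (v : Vec Carrier q) (w : Vec Carrier s) (k : ℕ) → 1 ≤ k →
    S (M^ k (u ++ v ++ w)) ≈
      S (M^ k u) + S (M^ k v) + S (M^ k w)
      + Σ1to k (λ l → S (M^ (k ∸ l) u) * fromℕ (((q +ℕ s) +ℕ l ∸ 1) C l)
                        + S (M^ (k ∸ l) v) * fromℕ ((s +ℕ l ∸ 1) C l))
corollary3 R p q s u v w k _ = begin
  S (M^ k (u ++ v ++ w))                                   ≈⟨ two-blocks u (v ++ w) k ⟩
  S (M^ k u) + S (M^ k (v ++ w)) + Σ1to k fu               ≈⟨ +-cong (+-cong refl (two-blocks v w k)) refl ⟩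
  S (M^ k u) + (S (M^ k v) + S (M^ k w) + Σ1to k fv) + Σ1to k fu ≈⟨ regroup _ _ _ _ _ ⟩
  S (M^ k u) + S (M^ k v) + S (M^ k w) + (Σ1to k fu + Σ1to k fv) ≈⟨ +-cong refl (sym (Σ-+ k fu fv)) ⟩
  S (M^ k u) + S (M^ k v) + S (M^ k w) + Σ1to k (λ l → fu l + fv l) ∎
  where
  open CommutativeRing R
  open Seq R
  open Blocks R
  open SetoidReasoning setoid

  fu fv : ℕ → Carrier
  fu l = S (M^ (k ∸ l) u) * fromℕ (((q +ℕ s) +ℕ l ∸ 1) C l)
  fv l = S (M^ (k ∸ l) v) * fromℕ ((s +ℕ l ∸ 1) C l)

  regroup : ∀ a b d x y → a + (b + d + y) + x ≈ a + b + d + (x + y)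
  regroup a b d x y = begin
    a + (b + d + y) + x   ≈⟨ +-cong (sym (+-assoc a (b + d) y)) refl ⟩
    a + (b + d) + y + x   ≈⟨ +-cong (+-cong (sym (+-assoc a b d)) refl) refl ⟩
    a + b + d + y + x     ≈⟨ +-assoc (a + b + d) y x ⟩
    a + b + d + (y + x)   ≈⟨ +-cong refl (+-comm y x) ⟩
    a + b + d + (x + y)   ∎
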